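{- Let $n\ge 3$ and $r,k$ be integers with $2\le k\le r+1$ and $r\le n$, and let $j\in\mathbb{Z}_n$. Then the $r$-graph $G(n,r,k-1,j)$ is $H_k^r$-free.
   Context: Identify the vertices of the oriented cycle $C_n$ with $\mathbb{Z}_n$, with arcs $(x,x+1)$. For nonempty $B\subseteq\mathbb{Z}_n$, the diameter $d(B)$ is the length of the shortest directed path in $C_n$ passing through all elements of $B$, i.e. the least $\ell\ge0$ such that $B\subseteq\{x,x+1,\dots,x+\ell\}$ for some $x\in B$. For $t\le|A|$, $d_t(A)=\min\{d(B): B\subseteq A, |B|=t\}$. For $1\le t\le r$ and $j\in\mathbb{Z}_n$, $G(n,r,t,j)$ is the $r$-graph with vertex set $\mathbb{Z}_n$ whose edges are the $r$-element subsets $A\subseteq\mathbb{Z}_n$ such that $j+\sum_{x\in A}x$ (computed in $\mathbb{Z}_n$) belongs to $\{0,1,\dots,d_t(A)\}$. $H_k^r$ is the $r$-graph with $r+1$ vertices and $k$ edges; $G$ is $H$-free if it contains no subgraph isomorphic to $H$. -}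

module Defs where

open import Data.Nat using (ℕ; zero; suc; _+_; _≤_; _<_)
open import Data.Nat.DivMod using (_%_)
open import Data.Fin using (Fin; toℕ)
open import Data.Fin.Subset using (Subset; _∈_; _⊆_; ∣_∣; ⁅_⁆; ∁; ⋃; ⊥)
open import Data.Vec using (lookup)
open import Data.Bool using (if_then_else_)
open import Data.List using (List; map; allFin)
open import Data.Nat.ListAction using (sum)
open import Data.Product using (Σ; ∃; _×_)
open import Relation.Binary.PropositionalEquality using (_≡_)
open import Relation.Nullary using (¬_)
open import Function.Definitions using (Injective)

-- reduction modulo n (only used for n ≥ 3; the n = 0 case is an arbitrary convention)
modN : ℕ → ℕ → ℕ
modN zero    m = m
modN (suc k) m = m % suc k

HGraph : ℕ → Set₁
HGraph n = Subset n → Set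

InWindow : ∀ {n} → Fin n → ℕ → Fin n → Set
InWindow {n} x ℓ y = ∃ λ i → i ≤ ℓ × toℕ y ≡ modN n (toℕ x + i)

Covers : ∀ {n} → Subset n → ℕ → Set
Covers B ℓ = ∃ λ x → x ∈ B × (∀ y → y ∈ B → InWindow x ℓ y)

Diam : ∀ {n} → Subset n → ℕ → Set
Diam B D = Covers B D × (∀ ℓ → Covers B ℓ → D ≤ ℓ)

MinDiam : ∀ {n} → Subset n → ℕ → ℕ → Set
MinDiam A t D =
  (∃ λ B → B ⊆ A × ∣ B ∣ ≡ t × Diam B D) ×
  (∀ B D' → B ⊆ A → ∣ B ∣ ≡ t → Diam B D' → D ≤ D')

sumSet : ∀ {n} → Subset n → ℕ
sumSet {n} A = sum (map (λ x → if lookup A x then toℕ x else 0) (allFin n))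

G : (n r t : ℕ) → Fin n → HGraph n
G n r t j A = ∣ A ∣ ≡ r × ∃ λ D → MinDiam A t D × modN n (toℕ j + sumSet A) ≤ D

-- H_k^r : vertex set Fin (r+1), edges the complements of the vertices i with i < k
-- (k ≤ r+1, so exactly k edges, each of size r; unique up to isomorphism)
H : (r k : ℕ) → HGraph (suc r)
H r k e = ∃ λ (i : Fin (suc r)) → toℕ i < k × e ≡ ∁ ⁅ i ⁆

image : ∀ {m n} → (Fin m → Fin n) → Subset m → Subset n
image {m} f A = ⋃ (map (λ x → if lookup A x then ⁅ f x ⁆ else ⊥) (allFin m))

Contains : ∀ {m n} → HGraph m → HGraph n → Set
Contains {m} {n} Hg Gg =
  Σ (Fin m → Fin n) λ f → Injective _≡_ _≡_ f × (∀ e → Hg e → Gg (image f e))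

Free : ∀ {m n} → HGraph m → HGraph n → Set
Free Hg Gg = ¬ Contains Hg Gg

-- Let S be the vertex set of a copy of H_k^r and v_0, …, v_{k-1} its vertices of degree k-1,
-- so that the edges are S ∖ {v_i}.  Writing σ = j + Σ S, the edge S ∖ {v_i} carries the
-- value δ_i = σ - v_i (mod n), and v_i = σ - δ_i.  Hence the δ_i are distinct; let δ_a be
-- the largest and δ_c the largest among the others.  Every other v_i equals v_c + (δ_c - δ_i),
-- so B = {v_i : i ≠ a} is a (k-1)-subset of S ∖ {v_a} with d(B) ≤ δ_c < δ_a, whereas the edge
-- condition for S ∖ {v_a} demands δ_a ≤ d_{k-1}(S ∖ {v_a}) ≤ d(B).
module Submission where

open import Defs
open import Data.Nat using (ℕ; suc; _≤_; _∸_)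
open import Data.Fin using (Fin)

open import Data.Bool using (true; false; if_then_else_)
open import Data.Fin using (toℕ; inject≤; punchIn) renaming (zero to fzero; suc to fsuc)
open import Data.Fin.Properties as Finₚ
  using (toℕ-injective; toℕ<n; toℕ-inject≤; inject≤-injective; punchIn-injective; punchInᵢ≢i; any?; all?)
open import Data.Fin.Subset using (Subset; inside; outside; _∈_; _∉_; _⊆_; ∣_∣; ⁅_⁆; ∁; ⋃; ⊤; ⊥; _-_)
open import Data.Fin.Subset.Properties
  using (_∈?_; ∉⊥; ∈⊤; ∣⊥∣≡0; x∈⁅x⁆; x∈⁅y⁆⇒x≡y; x≢y⇒x∉⁅y⁆; x∉p⇒x∈∁p; x∈∁p⇒x∉p;
         x∈p∪q⁻; x∈p∪q⁺; ⊆-antisym; p─⊥≡p; p─q⊆p; x∈p∧x≢y⇒x∈p-y)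
open import Data.List as List using (List; allFin)
open import Data.List.Properties using (map-tabulate)
open import Data.List.Membership.Propositional.Properties using (∈-allFin)
open import Data.List.Relation.Unary.Any as Any using (Any; satisfied)
open import Data.List.Relation.Unary.Any.Properties using (map⁺; map⁻)
open import Data.Nat as ℕ using (zero; _+_; _*_; _<_; s≤s; s≤s⁻¹)
open import Data.Nat.DivMod using (_%_; %-distribˡ-+; m%n%n≡m%n; [m+kn]%n≡m%n; m<n⇒m%n≡m)
open import Data.Nat.ListAction using (sum)
open import Data.Nat.Properties
open import Data.Product using (∃; ∃-syntax; _×_; _,_; proj₁; proj₂)
open import Data.Sum using (inj₁; inj₂)
open import Data.Vec using (lookup; _∷_; here; there)
open import Data.Vec.Properties using ([]=⇒lookup; lookup⇒[]=)
open import Function using (_∘_)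
open import Function.Definitions using (Injective)
open import Relation.Binary.PropositionalEquality
open import Relation.Nullary using (¬_; Dec; yes; no; contradiction)
open import Relation.Nullary.Decidable using (map′; _×-dec_; _→-dec_)
open import Relation.Unary using (Pred; Decidable)

private
  variable
    m n : ℕ

least : ∀ {p} {P : Pred ℕ p} → Decidable P → ∀ {ℓ} → P ℓ → ∃[ d ] (P d × (∀ ℓ′ → P ℓ′ → d ≤ ℓ′))
least {P = P} P? {ℓ} Pℓ = below ℓ (ℓ , ≤-refl , Pℓ)
  where
  below : ∀ u → ∃[ i ] (i ≤ u × P i) → ∃[ d ] (P d × (∀ ℓ′ → P ℓ′ → d ≤ ℓ′))
  below u (i , i≤u , Pi) with anyUpTo? P? u
  ... | no none = i , Pi , λ ℓ′ Pℓ′ → ≮⇒≥ λ ℓ′<i → none (ℓ′ , <-≤-trans ℓ′<i i≤u , Pℓ′)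
  below (suc u) _ | yes (i , i<1+u , Pi) = below u (i , s≤s⁻¹ i<1+u , Pi)

argmax : (h : Fin (suc m) → ℕ) → ∃[ a ] (∀ i → h i ≤ h a)
argmax {zero} h = fzero , λ { fzero → ≤-refl }
argmax {suc m} h with argmax (h ∘ fsuc)
... | a , a-max with h fzero ≤? h (fsuc a)
...   | yes h0≤ha = fsuc a , λ { fzero → h0≤ha ; (fsuc i) → a-max i }
...   | no h0≰ha = fzero , λ { fzero → ≤-refl ; (fsuc i) → ≤-trans (a-max i) (<⇒≤ (≰⇒> h0≰ha)) }

[m%n+o]%n≡[m+o]%n : ∀ m o n .{{_ : ℕ.NonZero n}} → (m % n + o) % n ≡ (m + o) % n
[m%n+o]%n≡[m+o]%n m o n = begin
  (m % n + o) % n           ≡⟨ %-distribˡ-+ (m % n) o n ⟩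
  (m % n % n + o % n) % n   ≡⟨ cong (λ z → (z + o % n) % n) (m%n%n≡m%n m n) ⟩
  (m % n + o % n) % n       ≡⟨ %-distribˡ-+ m o n ⟨
  (m + o) % n               ∎
  where open ≡-Reasoning

%-cancelʳ-+ : ∀ N u v o → (u + o) % suc N ≡ (v + o) % suc N → u % suc N ≡ v % suc N
%-cancelʳ-+ N u v o eq = begin
  u % d                           ≡⟨ [m+kn]%n≡m%n u o d ⟨
  (u + o * d) % d                 ≡⟨ cong (_% d) (regroup u) ⟩
  ((u + o) + o * N) % d           ≡⟨ %-distribˡ-+ (u + o) (o * N) d ⟩
  ((u + o) % d + o * N % d) % d   ≡⟨ cong (λ z → (z + o * N % d) % d) eq ⟩
  ((v + o) % d + o * N % d) % d   ≡⟨ %-distribˡ-+ (v + o) (o * N) d ⟨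
  ((v + o) + o * N) % d           ≡⟨ cong (_% d) (regroup v) ⟨
  (v + o * d) % d                 ≡⟨ [m+kn]%n≡m%n v o d ⟩
  v % d                           ∎
  where
  open ≡-Reasoning
  d = suc N
  regroup : ∀ w → w + o * d ≡ (w + o) + o * N
  regroup w = trans (cong (w +_) (*-suc o N)) (sym (+-assoc w o (o * N)))

offset-%-≡ : ∀ N {x y dx dy} → x < suc N → (x + dx) % suc N ≡ (y + dy) % suc N → dx ≤ dy →
             x ≡ (y + (dy ∸ dx)) % suc N
offset-%-≡ N {x} {y} {dx} {dy} x<n eq dx≤dy = begin
  x                      ≡⟨ m<n⇒m%n≡m x<n ⟨
  x % suc N              ≡⟨ %-cancelʳ-+ N x (y + (dy ∸ dx)) dx (trans eq (cong (_% suc N) shift)) ⟩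
  (y + (dy ∸ dx)) % suc N ∎
  where
  open ≡-Reasoning
  shift : y + dy ≡ y + (dy ∸ dx) + dx
  shift = trans (cong (y +_) (sym (m∸n+n≡m dx≤dy))) (sym (+-assoc y (dy ∸ dx) dx))

x∉p-x : ∀ {x : Fin n} {p : Subset n} → x ∉ p - x
x∉p-x {x = fzero} {_ ∷ _} ()
x∉p-x {x = fsuc x} {_ ∷ _} (there x∈p-x) = x∉p-x x∈p-x

∣p-x∣+1≡∣p∣ : ∀ {x : Fin n} {p : Subset n} → x ∈ p → suc ∣ p - x ∣ ≡ ∣ p ∣
∣p-x∣+1≡∣p∣ (here {xs = p}) = cong (suc ∘ ∣_∣) (p─⊥≡p p)
∣p-x∣+1≡∣p∣ (there {y = inside} x∈p) = cong suc (∣p-x∣+1≡∣p∣ x∈p)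
∣p-x∣+1≡∣p∣ (there {y = outside} x∈p) = ∣p-x∣+1≡∣p∣ x∈p

-- sumSet in the form List.tabulate, which unfolds along the cons structure of a subset.
weightedSum : (Fin n → ℕ) → Subset n → ℕ
weightedSum w p = sum (List.tabulate λ y → if lookup p y then w y else 0)

weightedSum-remove : ∀ (w : Fin n → ℕ) {x p} → x ∈ p → weightedSum w (p - x) + w x ≡ weightedSum w p
weightedSum-remove w (here {xs = p}) =
  trans (cong (_+ w fzero) (cong (weightedSum (w ∘ fsuc)) (p─⊥≡p p))) (+-comm _ (w fzero))
weightedSum-remove w (there {y = b} {xs = p} x∈p) =
  trans (+-assoc (if b then w fzero else 0) _ _)
        (cong ((if b then w fzero else 0) +_) (weightedSum-remove (w ∘ fsuc) x∈p))

sumSet≡weightedSum : (p : Subset n) → sumSet p ≡ weightedSum toℕ p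
sumSet≡weightedSum p = cong sum (map-tabulate (λ y → y) (λ y → if lookup p y then toℕ y else 0))

sumSet-remove : ∀ {x : Fin n} {p} → x ∈ p → sumSet (p - x) + toℕ x ≡ sumSet p
sumSet-remove {x = x} {p} x∈p = begin
  sumSet (p - x) + toℕ x            ≡⟨ cong (_+ toℕ x) (sumSet≡weightedSum (p - x)) ⟩
  weightedSum toℕ (p - x) + toℕ x   ≡⟨ weightedSum-remove toℕ x∈p ⟩
  weightedSum toℕ p                 ≡⟨ sumSet≡weightedSum p ⟨
  sumSet p                          ∎
  where open ≡-Reasoning

∈-⋃⁻ : ∀ {y : Fin n} (qs : List (Subset n)) → y ∈ ⋃ qs → Any (y ∈_) qs
∈-⋃⁻ List.[] y∈ = contradiction y∈ ∉⊥
∈-⋃⁻ (q List.∷ qs) y∈ with x∈p∪q⁻ q (⋃ qs) y∈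
... | inj₁ y∈q = Any.here y∈q
... | inj₂ y∈qs = Any.there (∈-⋃⁻ qs y∈qs)

∈-⋃⁺ : ∀ {y : Fin n} {qs : List (Subset n)} → Any (y ∈_) qs → y ∈ ⋃ qs
∈-⋃⁺ (Any.here y∈q) = x∈p∪q⁺ (inj₁ y∈q)
∈-⋃⁺ (Any.there y∈qs) = x∈p∪q⁺ (inj₂ (∈-⋃⁺ y∈qs))

∈-image⁺ : ∀ (f : Fin m → Fin n) p {x} → x ∈ p → f x ∈ image f p
∈-image⁺ f p {x} x∈p = ∈-⋃⁺ (map⁺ (Any.map (λ { refl → fx∈ }) (∈-allFin x)))
  where
  fx∈ : f x ∈ (if lookup p x then ⁅ f x ⁆ else ⊥)
  fx∈ rewrite []=⇒lookup x∈p = x∈⁅x⁆ (f x)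

∈-image-⊤ : ∀ (f : Fin m → Fin n) x → f x ∈ image f ⊤
∈-image-⊤ f x = ∈-image⁺ f ⊤ ∈⊤

∈-image⁻ : ∀ (f : Fin m → Fin n) p {y} → y ∈ image f p → ∃[ x ] (x ∈ p × f x ≡ y)
∈-image⁻ {m} f p y∈ with satisfied (map⁻ (∈-⋃⁻ (List.map part (allFin m)) y∈))
  where
  part : Fin m → Subset _
  part x = if lookup p x then ⁅ f x ⁆ else ⊥
... | x , y∈fx = x , from-branch (lookup p x) refl y∈fx
  where
  from-branch : ∀ {x y} b → lookup p x ≡ b → y ∈ (if b then ⁅ f x ⁆ else ⊥) → x ∈ p × f x ≡ y
  from-branch {x} true  eq y∈fx = lookup⇒[]= x p eq , sym (x∈⁅y⁆⇒x≡y (f x) y∈fx)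
  from-branch false _ y∈⊥ = contradiction y∈⊥ ∉⊥

image-∁⁅⁆ : ∀ {f : Fin m → Fin n} → Injective _≡_ _≡_ f → ∀ i → image f (∁ ⁅ i ⁆) ≡ image f ⊤ - f i
image-∁⁅⁆ {f = f} f-inj i = ⊆-antisym into onto
  where
  into : image f (∁ ⁅ i ⁆) ⊆ image f ⊤ - f i
  into y∈ with ∈-image⁻ f (∁ ⁅ i ⁆) y∈
  ... | x , x∈∁i , refl = x∈p∧x≢y⇒x∈p-y (∈-image-⊤ f x)
          λ fx≡fi → x∈∁p⇒x∉p x∈∁i (subst (_∈ ⁅ i ⁆) (sym (f-inj fx≡fi)) (x∈⁅x⁆ i))
  onto : image f ⊤ - f i ⊆ image f (∁ ⁅ i ⁆)
  onto y∈ with ∈-image⁻ f ⊤ (p─q⊆p (image f ⊤) ⁅ f i ⁆ y∈)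
  ... | x , _ , refl = ∈-image⁺ f (∁ ⁅ i ⁆) (x∉p⇒x∈∁p λ x∈⁅i⁆ →
          x∉p-x (subst (λ z → f x ∈ image f ⊤ - f z) (sym (x∈⁅y⁆⇒x≡y i x∈⁅i⁆)) y∈))

image-∘suc : ∀ (f : Fin (suc m) → Fin n) → image (f ∘ fsuc) ⊤ ≡ image f (∁ ⁅ fzero ⁆)
image-∘suc f = ⊆-antisym into onto
  where
  into : image (f ∘ fsuc) ⊤ ⊆ image f (∁ ⁅ fzero ⁆)
  into y∈ with ∈-image⁻ (f ∘ fsuc) ⊤ y∈
  ... | x , _ , refl =
          ∈-image⁺ f (∁ ⁅ fzero ⁆) (x∉p⇒x∈∁p (x≢y⇒x∉⁅y⁆ {x = fsuc x} {y = fzero} λ ()))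
  onto : image f (∁ ⁅ fzero ⁆) ⊆ image (f ∘ fsuc) ⊤
  onto y∈ with ∈-image⁻ f (∁ ⁅ fzero ⁆) y∈
  ... | fzero , 0∈∁0 , _ = contradiction (x∈⁅x⁆ fzero) (x∈∁p⇒x∉p 0∈∁0)
  ... | fsuc x , _ , refl = ∈-image-⊤ (f ∘ fsuc) x

∣image∣≡ : ∀ {f : Fin m → Fin n} → Injective _≡_ _≡_ f → ∣ image f ⊤ ∣ ≡ m
∣image∣≡ {zero} {n} _ = ∣⊥∣≡0 n
∣image∣≡ {suc m} {f = f} f-inj = begin
  ∣ image f ⊤ ∣                 ≡⟨ ∣p-x∣+1≡∣p∣ (∈-image-⊤ f _) ⟨
  suc ∣ image f ⊤ - f fzero ∣   ≡⟨ cong (suc ∘ ∣_∣) (image-∁⁅⁆ f-inj fzero) ⟨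
  suc ∣ image f (∁ ⁅ fzero ⁆) ∣ ≡⟨ cong (suc ∘ ∣_∣) (image-∘suc f) ⟨
  suc ∣ image (f ∘ fsuc) ⊤ ∣    ≡⟨ cong suc (∣image∣≡ (Finₚ.suc-injective ∘ f-inj)) ⟩
  suc m                         ∎
  where open ≡-Reasoning

inWindow? : ∀ (x : Fin n) ℓ y → Dec (InWindow x ℓ y)
inWindow? {n} x ℓ y =
  map′ (λ (i , i<1+ℓ , eq) → i , s≤s⁻¹ i<1+ℓ , eq) (λ (i , i≤ℓ , eq) → i , s≤s i≤ℓ , eq)
       (anyUpTo? (λ i → toℕ y ℕ.≟ modN n (toℕ x + i)) (suc ℓ))

covers? : ∀ (B : Subset n) ℓ → Dec (Covers B ℓ)
covers? B ℓ = any? λ x → x ∈? B ×-dec all? λ y → y ∈? B →-dec inWindow? x ℓ y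

diameter : ∀ {B : Subset n} {ℓ} → Covers B ℓ → ∃ (Diam B)
diameter {B = B} = least (covers? B)

module Deletions {N : ℕ} (j : Fin (suc N)) (S : Subset (suc N)) where

  σ : ℕ
  σ = toℕ j + sumSet S

  δ : Fin (suc N) → ℕ
  δ x = (toℕ j + sumSet (S - x)) % suc N

  x+δ≡σ : ∀ {x} → x ∈ S → (toℕ x + δ x) % suc N ≡ σ % suc N
  x+δ≡σ {x} x∈S = begin
    (toℕ x + δ x) % suc N                        ≡⟨ cong (_% suc N) (+-comm (toℕ x) (δ x)) ⟩
    (δ x + toℕ x) % suc N                        ≡⟨ [m%n+o]%n≡[m+o]%n (toℕ j + sumSet (S - x)) (toℕ x) (suc N) ⟩
    (toℕ j + sumSet (S - x) + toℕ x) % suc N     ≡⟨ cong (_% suc N) (+-assoc (toℕ j) _ _) ⟩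
    (toℕ j + (sumSet (S - x) + toℕ x)) % suc N   ≡⟨ cong (λ z → (toℕ j + z) % suc N) (sumSet-remove x∈S) ⟩
    σ % suc N                                    ∎
    where open ≡-Reasoning

  δ-offset : ∀ {x y} → x ∈ S → y ∈ S → δ y ≤ δ x →
             toℕ y ≡ (toℕ x + (δ x ∸ δ y)) % suc N
  δ-offset {x} {y} x∈S y∈S = offset-%-≡ N {y = toℕ x} {dx = δ y} {dy = δ x} (toℕ<n y)
    (trans (x+δ≡σ y∈S) (sym (x+δ≡σ x∈S)))

  δ-injective : ∀ {x y} → x ∈ S → y ∈ S → δ x ≡ δ y → x ≡ y
  δ-injective {x} {y} x∈S y∈S eq = toℕ-injective (sym (begin
    toℕ y                          ≡⟨ δ-offset x∈S y∈S (≤-reflexive (sym eq)) ⟩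
    (toℕ x + (δ x ∸ δ y)) % suc N  ≡⟨ cong (λ z → (toℕ x + z) % suc N) δx∸δy≡0 ⟩
    (toℕ x + 0) % suc N            ≡⟨ cong (_% suc N) (+-identityʳ (toℕ x)) ⟩
    toℕ x % suc N                  ≡⟨ m<n⇒m%n≡m (toℕ<n x) ⟩
    toℕ x                          ∎))
    where
    open ≡-Reasoning
    δx∸δy≡0 : δ x ∸ δ y ≡ 0
    δx∸δy≡0 = trans (cong (_∸ δ y) eq) (n∸n≡0 (δ y))

  ¬all-deletions-edges : ∀ {r t} (v : Fin (suc (suc t)) → Fin (suc N)) → Injective _≡_ _≡_ v →
                         (∀ i → v i ∈ S) → ¬ (∀ i → G (suc N) r (suc t) j (S - v i))
  ¬all-deletions-edges v v-inj v∈S edge with argmax (δ ∘ v)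
  ... | a , a-max with edge a
  ...   | _ , D , (_ , D-min) , δa≤D = <⇒≱ δc<δa (begin
          δ (v a)  ≤⟨ δa≤D ⟩
          D        ≤⟨ D-min B D′ B⊆S-va (∣image∣≡ w-inj) B-diam ⟩
          D′       ≤⟨ proj₂ B-diam (δ (w c)) B-covered ⟩
          δ (w c)  ∎)
    where
    open ≤-Reasoning
    w : Fin (suc _) → Fin (suc N)
    w = v ∘ punchIn a
    w-inj : Injective _≡_ _≡_ w
    w-inj = punchIn-injective a _ _ ∘ v-inj
    c : Fin (suc _)
    c = proj₁ (argmax (δ ∘ w))
    B : Subset (suc N)
    B = image w ⊤
    B⊆S-va : B ⊆ S - v a
    B⊆S-va y∈B with ∈-image⁻ w ⊤ y∈B
    ... | x , _ , refl = x∈p∧x≢y⇒x∈p-y (v∈S _) (punchInᵢ≢i a x ∘ v-inj)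
    δc<δa : δ (w c) < δ (v a)
    δc<δa = ≤∧≢⇒< (a-max (punchIn a c))
                  (punchInᵢ≢i a c ∘ v-inj ∘ δ-injective (v∈S _) (v∈S a))
    B-covered : Covers B (δ (w c))
    B-covered = w c , ∈-image-⊤ w c , window
      where
      window : ∀ y → y ∈ B → InWindow (w c) (δ (w c)) y
      window y y∈B with ∈-image⁻ w ⊤ y∈B
      ... | x , _ , refl = δ (w c) ∸ δ (w x) , m∸n≤m (δ (w c)) (δ (w x)) ,
                           δ-offset (v∈S _) (v∈S _) (proj₂ (argmax (δ ∘ w)) x)
    D′ : ℕ
    D′ = proj₁ (diameter B-covered)
    B-diam : Diam B D′
    B-diam = proj₂ (diameter B-covered)

theorem7 : (n r k : ℕ) → 3 ≤ n → 2 ≤ k → k ≤ suc r → r ≤ n → (j : Fin n) → Free (H r k) (G n r (k ∸ 1) j)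
theorem7 (suc N) r (suc (suc t)) _ (s≤s (s≤s _)) k≤1+r _ j (f , f-inj , H⊆G) =
  Deletions.¬all-deletions-edges j (image f ⊤) v v-inj (λ i → ∈-image-⊤ f (inject≤ i k≤1+r)) edge
  where
  v : Fin (suc (suc t)) → Fin (suc N)
  v i = f (inject≤ i k≤1+r)
  v-inj : Injective _≡_ _≡_ v
  v-inj = inject≤-injective k≤1+r k≤1+r _ _ ∘ f-inj
  edge : ∀ i → G (suc N) r (suc t) j (image f ⊤ - v i)
  edge i = subst (G (suc N) r (suc t) j) (image-∁⁅⁆ f-inj (inject≤ i k≤1+r))
    (H⊆G _ (inject≤ i k≤1+r , subst (_< suc (suc t)) (sym (toℕ-inject≤ i k≤1+r)) (toℕ<n i) , refl))
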